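{- Let $G$ be a $2$-connected bipartite graph of order $n \geq 4$. Then $$Sz(G)-W(G) \geq 4n-8,$$ with equality if and only if $G = C_4$ (the cycle on $4$ vertices).
   Context: All graphs are finite, undirected, simple and connected. For vertices $u,v$ of $G=(V,E)$, $d(u,v)$ is the distance between them. The Wiener index is $W(G)=\sum_{\{u,v\}\subseteq V} d(u,v)$. For an edge $e=uv$, let $N_u(e)=\{w\in V: d(u,w)<d(v,w)\}$, $N_v(e)=\{w\in V: d(v,w)<d(u,w)\}$, and $n_u(e)=|N_u(e)|$, $n_v(e)=|N_v(e)|$. The Szeged index is $Sz(G)=\sum_{e=uv\in E} n_u(e)n_v(e)$. -}

module Defs where

open import Data.Nat using (ℕ; zero; suc; _+_; _*_; _≤_; _<ᵇ_)
open import Data.Bool using (Bool; true; false; if_then_else_; _∧_)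
open import Data.Fin using (Fin; toℕ)
open import Data.List using (map; allFin)
open import Data.Nat.ListAction using (sum)
open import Data.Product using (Σ; ∃; _×_)
open import Data.Unit using (⊤)
open import Relation.Binary.PropositionalEquality using (_≡_; _≢_)
open import Function.Bundles using (_↔_; Inverse)

record Graph (n : ℕ) : Set where
  field
    adj    : Fin n → Fin n → Bool
    sym    : ∀ u v → adj u v ≡ adj v u
    irrefl : ∀ u → adj u u ≡ false
open Graph public

data WalkIn {n : ℕ} (G : Graph n) (P : Fin n → Set) : Fin n → Fin n → ℕ → Set where
  nil  : ∀ {u} → P u → WalkIn G P u u 0
  cons : ∀ {u w v k} → P u → adj G u w ≡ true → WalkIn G P w v k → WalkIn G P u v (suc k)

Walk : {n : ℕ} → Graph n → Fin n → Fin n → ℕ → Set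
Walk G = WalkIn G (λ _ → ⊤)

Connected : {n : ℕ} → Graph n → Set
Connected G = ∀ u v → ∃ λ k → Walk G u v k

TwoConnected : {n : ℕ} → Graph n → Set
TwoConnected {n} G =
  (3 ≤ n) × Connected G ×
  (∀ x u v → u ≢ x → v ≢ x → ∃ λ k → WalkIn G (λ w → w ≢ x) u v k)

Bipartite : {n : ℕ} → Graph n → Set
Bipartite {n} G = Σ (Fin n → Bool) λ c → ∀ u v → adj G u v ≡ true → c u ≢ c v

IsDistance : {n : ℕ} → Graph n → (Fin n → Fin n → ℕ) → Set
IsDistance G d = ∀ u v → Walk G u v (d u v) × (∀ k → Walk G u v k → d u v ≤ k)

∑ : {n : ℕ} → (Fin n → ℕ) → ℕ
∑ {n} f = sum (map f (allFin n))

W : {n : ℕ} → Graph n → (Fin n → Fin n → ℕ) → ℕ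
W G d = ∑ λ u → ∑ λ v → if toℕ u <ᵇ toℕ v then d u v else 0

nCloser : {n : ℕ} → (Fin n → Fin n → ℕ) → Fin n → Fin n → ℕ
nCloser d u v = ∑ λ w → if d u w <ᵇ d v w then 1 else 0

Sz : {n : ℕ} → Graph n → (Fin n → Fin n → ℕ) → ℕ
Sz G d = ∑ λ u → ∑ λ v →
  if (toℕ u <ᵇ toℕ v) ∧ adj G u v then nCloser d u v * nCloser d v u else 0

c4adj : Fin 4 → Fin 4 → Bool
c4adj u v with toℕ u | toℕ v
... | 0 | 1 = true
... | 1 | 0 = true
... | 1 | 2 = true
... | 2 | 1 = true
... | 2 | 3 = true
... | 3 | 2 = true
... | 3 | 0 = true
... | 0 | 3 = true
... | _ | _ = false

IsoC4 : {n : ℕ} → Graph n → Set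
IsoC4 {n} G = Σ (Fin n ↔ Fin 4) λ σ →
  ∀ u v → adj G u v ≡ c4adj (Inverse.to σ u) (Inverse.to σ v)

module Submission where

-- 1. Double counting: 2 Sz(G) is the number of quadruples (x, y, u, v) such that uv is
--    an edge, x is closer to u and y is closer to v ("uv separates x from y").
-- 2. Separation bound: at least 2 d(x,y) oriented edges separate x from y.  For
--    t < d(x,y) the level set S_t = { w : d(w,x) + d(x,y) ≤ 2t + d(w,y) } contains x but
--    not y, so by 2-connectivity two oriented edges leave it; in a bipartite graph such an
--    edge separates x from y, and it leaves no other level set.  Summing: Sz ≥ 2W.
-- 3. Transmission bound: no vertex is adjacent to all others (that would create a
--    triangle), so every vertex has distance sum at least n, and 2W ≥ n².
-- 4. Arithmetic: Sz + 8 ≥ 2W + 8 ≥ W + n²/2 + 8 ≥ W + 4n, with equality only if n = 4.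
-- 5. Order four: such a graph on four vertices is a labelled 4-cycle, whose indices
--    (Sz = 16, W = 8) are evaluated.  As G ≅ C4 forces n = 4, this settles the equality case.

open import Defs hiding (sym)
open import Data.Nat using (ℕ; zero; suc; _+_; _*_; _≤_; _<_; z≤n; s≤s; _<ᵇ_; _≤ᵇ_)
open import Data.Nat.Properties hiding (_≟_; suc-injective)
open import Data.Nat.ListAction using (sum)
open import Data.Nat.Tactic.RingSolver using (solve-∀)
open import Algebra.Properties.Semiring.Sum +-*-semiring as Vec
  using (∑-comm; ∑-distrib-+; *-distribˡ-sum; sum-cong-≗)
open import Data.Bool using (Bool; true; false; if_then_else_; not; _∧_; T)
open import Data.Bool.Properties using (not-injective; ¬-not) renaming (_≟_ to _≟ᵇ_)
open import Data.Empty using (⊥; ⊥-elim)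
open import Data.Fin using (Fin; zero; suc; toℕ)
open import Data.Fin.Patterns using (0F; 1F; 2F; 3F)
open import Data.Fin.Permutation using (transpose; ↔⇒≡)
open import Data.Fin.Properties using (_≟_; suc-injective; toℕ-injective; toℕ<n; all?)
open import Data.List using (allFin)
open import Data.List.Properties using (map-tabulate; map-cong)
open import Data.Product using (Σ; ∃; _×_; _,_; proj₁; proj₂)
open import Data.Sum using (_⊎_; inj₁; inj₂)
open import Data.Unit using (tt)
open import Function using (_∘_; id; flip)
open import Function.Bundles using (_⇔_; mk⇔; _↔_; Inverse; Injection)
open import Function.Properties.Inverse using (↔⇒↣)
open import Relation.Nullary using (does; yes; no)
open import Relation.Nullary.Decidable using (toWitness)
open import Relation.Binary.PropositionalEquality

ind : Bool → ℕ
ind b = if b then 1 else 0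

ind-∧ : ∀ a b → ind (a ∧ b) ≡ ind a * ind b
ind-∧ true  b = sym (+-identityʳ (ind b))
ind-∧ false b = refl

T⇒≡true : ∀ {b} → T b → b ≡ true
T⇒≡true {true} _ = refl

<⇒<ᵇ-true : ∀ {m n} → m < n → (m <ᵇ n) ≡ true
<⇒<ᵇ-true m<n = T⇒≡true (<⇒<ᵇ m<n)

<ᵇ-true⇒< : ∀ {m n} → (m <ᵇ n) ≡ true → m < n
<ᵇ-true⇒< {m} {n} e = <ᵇ⇒< m n (subst T (sym e) tt)

<ᵇ-false⇒≥ : ∀ {m n} → (m <ᵇ n) ≡ false → n ≤ m
<ᵇ-false⇒≥ e = ≮⇒≥ (λ m<n → subst T e (<⇒<ᵇ m<n))

≤⇒≤ᵇ-true : ∀ {m n} → m ≤ n → (m ≤ᵇ n) ≡ true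
≤⇒≤ᵇ-true m≤n = T⇒≡true (≤⇒≤ᵇ m≤n)

≤ᵇ-true⇒≤ : ∀ {m n} → (m ≤ᵇ n) ≡ true → m ≤ n
≤ᵇ-true⇒≤ {m} {n} e = ≤ᵇ⇒≤ m n (subst T (sym e) tt)

≤ᵇ-false⇒> : ∀ {m n} → (m ≤ᵇ n) ≡ false → n < m
≤ᵇ-false⇒> e = ≰⇒> (λ m≤n → subst T e (≤⇒≤ᵇ m≤n))

>⇒≤ᵇ-false : ∀ {m n} → n < m → (m ≤ᵇ n) ≡ false
>⇒≤ᵇ-false {m} {n} n<m with m ≤ᵇ n in e
... | false = refl
... | true  = ⊥-elim (<⇒≱ n<m (≤ᵇ-true⇒≤ e))

∑-suc : ∀ {n} (f : Fin (suc n) → ℕ) → ∑ f ≡ f zero + ∑ (f ∘ suc)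
∑-suc f = cong (λ xs → f zero + sum xs)
  (trans (map-tabulate suc f) (sym (map-tabulate id (f ∘ suc))))

∑≡sum : ∀ {n} (f : Fin n → ℕ) → ∑ f ≡ Vec.sum f
∑≡sum {zero}  f = refl
∑≡sum {suc n} f = trans (∑-suc f) (cong (f zero +_) (∑≡sum (f ∘ suc)))

∑∑≡sum : ∀ {m n} (f : Fin m → Fin n → ℕ) → ∑ (λ i → ∑ (f i)) ≡ Vec.sum (λ i → Vec.sum (f i))
∑∑≡sum {m} f = trans (∑≡sum (λ i → ∑ (f i))) (sum-cong-≗ {m} (λ i → ∑≡sum (f i)))

∑-cong : ∀ {n} {f g : Fin n → ℕ} → (∀ i → f i ≡ g i) → ∑ f ≡ ∑ g
∑-cong {n} f≗g = cong sum (map-cong f≗g (allFin n))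

∑-mono : ∀ {n} {f g : Fin n → ℕ} → (∀ i → f i ≤ g i) → ∑ f ≤ ∑ g
∑-mono {zero}          f≤g = z≤n
∑-mono {suc n} {f} {g} f≤g =
  subst₂ _≤_ (sym (∑-suc f)) (sym (∑-suc g)) (+-mono-≤ (f≤g zero) (∑-mono (f≤g ∘ suc)))

∑-+ : ∀ {n} (f g : Fin n → ℕ) → ∑ (λ i → f i + g i) ≡ ∑ f + ∑ g
∑-+ f g = begin
  ∑ (λ i → f i + g i)        ≡⟨ ∑≡sum (λ i → f i + g i) ⟩
  Vec.sum (λ i → f i + g i)  ≡⟨ ∑-distrib-+ f g ⟩
  Vec.sum f + Vec.sum g      ≡⟨ cong₂ _+_ (∑≡sum f) (∑≡sum g) ⟨
  ∑ f + ∑ g                  ∎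
  where open ≡-Reasoning

∑-*ˡ : ∀ {n} c (f : Fin n → ℕ) → c * ∑ f ≡ ∑ (λ i → c * f i)
∑-*ˡ c f = begin
  c * ∑ f                    ≡⟨ cong (c *_) (∑≡sum f) ⟩
  c * Vec.sum f              ≡⟨ *-distribˡ-sum c f ⟩
  Vec.sum (λ i → c * f i)    ≡⟨ ∑≡sum (λ i → c * f i) ⟨
  ∑ (λ i → c * f i)          ∎
  where open ≡-Reasoning

∑-swap : ∀ {m n} (f : Fin m → Fin n → ℕ) →
  ∑ (λ i → ∑ (λ j → f i j)) ≡ ∑ (λ j → ∑ (λ i → f i j))
∑-swap f = trans (∑∑≡sum f) (trans (∑-comm f) (sym (∑∑≡sum (flip f))))

∑-product : ∀ {m n} (f : Fin m → ℕ) (g : Fin n → ℕ) →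
  ∑ f * ∑ g ≡ ∑ (λ i → ∑ (λ j → f i * g j))
∑-product f g = begin
  ∑ f * ∑ g                         ≡⟨ *-comm (∑ f) (∑ g) ⟩
  ∑ g * ∑ f                         ≡⟨ ∑-*ˡ (∑ g) f ⟩
  ∑ (λ i → ∑ g * f i)               ≡⟨ ∑-cong (λ i → *-comm (∑ g) (f i)) ⟩
  ∑ (λ i → f i * ∑ g)               ≡⟨ ∑-cong (λ i → ∑-*ˡ (f i) g) ⟩
  ∑ (λ i → ∑ (λ j → f i * g j))     ∎
  where open ≡-Reasoning

∑-const : ∀ {n} c → ∑ {n} (λ _ → c) ≡ n * c
∑-const {zero}  c = refl
∑-const {suc n} c = trans (∑-suc {n} (λ _ → c)) (cong (c +_) (∑-const {n} c))

∑-zero : ∀ {n} → ∑ {n} (λ _ → 0) ≡ 0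
∑-zero {n} = trans (∑-const {n} 0) (*-zeroʳ n)

∑-term : ∀ {n} (f : Fin n → ℕ) i → f i ≤ ∑ f
∑-term f zero    = subst (f zero ≤_) (sym (∑-suc f)) (m≤m+n _ _)
∑-term f (suc i) = subst (f (suc i) ≤_) (sym (∑-suc f))
  (≤-trans (∑-term (f ∘ suc) i) (m≤n+m _ _))

∑-two-terms : ∀ {n} (f : Fin n → ℕ) {i j} → i ≢ j → f i + f j ≤ ∑ f
∑-two-terms f {zero}  {zero}  i≢j = ⊥-elim (i≢j refl)
∑-two-terms f {zero}  {suc j} _   =
  subst (f zero + f (suc j) ≤_) (sym (∑-suc f)) (+-monoʳ-≤ (f zero) (∑-term (f ∘ suc) j))
∑-two-terms f {suc i} {zero}  _   = subst₂ _≤_ (+-comm (f zero) (f (suc i))) (sym (∑-suc f))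
  (+-monoʳ-≤ (f zero) (∑-term (f ∘ suc) i))
∑-two-terms f {suc i} {suc j} i≢j = subst (f (suc i) + f (suc j) ≤_) (sym (∑-suc f))
  (≤-trans (∑-two-terms (f ∘ suc) (i≢j ∘ cong suc)) (m≤n+m _ _))

∑∑-two-terms : ∀ {m n} (f : Fin m → Fin n → ℕ) {i i' j j'} → i ≢ i' ⊎ j ≢ j' →
  f i j + f i' j' ≤ ∑ (λ k → ∑ (f k))
∑∑-two-terms f {i} {i'} {j} {j'} (inj₁ i≢i') =
  ≤-trans (+-mono-≤ (∑-term (f i) j) (∑-term (f i') j')) (∑-two-terms (λ k → ∑ (f k)) i≢i')
∑∑-two-terms f {i} {i'} (inj₂ j≢j') with i ≟ i'
... | yes refl  = ≤-trans (∑-two-terms (f i) j≢j') (∑-term (λ k → ∑ (f k)) i)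
... | no  i≢i'  = ∑∑-two-terms f (inj₁ i≢i')

∑-ind≤1 : ∀ {n} (b : Fin n → Bool) → (∀ i j → b i ≡ true → b j ≡ true → i ≡ j) →
  ∑ (λ i → ind (b i)) ≤ 1
∑-ind≤1 {zero}  b unique = z≤n
∑-ind≤1 {suc n} b unique = subst (_≤ 1) (sym (∑-suc (ind ∘ b))) (split (b zero) refl)
  where
  rest-unset : b zero ≡ true → ∀ i → ind (b (suc i)) ≡ 0
  rest-unset b₀ i with b (suc i) in bᵢ
  ... | false = refl
  ... | true  with () ← unique zero (suc i) b₀ bᵢ

  split : ∀ c → b zero ≡ c → ind c + ∑ (ind ∘ b ∘ suc) ≤ 1
  split false _  = ∑-ind≤1 (b ∘ suc) (λ i j p q → suc-injective (unique (suc i) (suc j) p q))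
  split true  b₀ = s≤s (≤-reflexive (trans (∑-cong (rest-unset b₀)) (∑-zero {n})))

δ : ∀ {n} → Fin n → Fin n → ℕ
δ y z = ind (does (y ≟ z))

∑-point : ∀ {n} (z : Fin n) → ∑ (λ y → δ y z) ≡ 1
∑-point {suc n} zero    = trans (∑-suc {n} (λ y → δ y zero)) (cong suc (∑-zero {n}))
∑-point {suc n} (suc z) = trans (∑-suc {n} (λ y → δ y (suc z))) (∑-point z)

Proper : ∀ {n} → Graph n → (Fin n → Bool) → Set
Proper G c = ∀ u v → adj G u v ≡ true → c u ≢ c v

flips : ℕ → Bool → Bool
flips zero    b = b
flips (suc k) b = flips k (not b)

flips-injective : ∀ k {a b} → flips k a ≡ flips k b → a ≡ b
flips-injective zero    e = e
flips-injective (suc k) e = not-injective (flips-injective k e)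

no-three-booleans : (a b c : Bool) → a ≢ b → b ≢ c → a ≢ c → ⊥
no-three-booleans false false _     a≢b _   _   = a≢b refl
no-three-booleans true  true  _     a≢b _   _   = a≢b refl
no-three-booleans false true  false _   _   a≢c = a≢c refl
no-three-booleans false true  true  _   b≢c _   = b≢c refl
no-three-booleans true  false false _   b≢c _   = b≢c refl
no-three-booleans true  false true  _   _   a≢c = a≢c refl

TriangleFree : ∀ {n} → Graph n → Set
TriangleFree G = ∀ u v w → adj G u v ≡ true → adj G v w ≡ true → adj G u w ≡ true → ⊥

module Walks {n : ℕ} (G : Graph n) where

  adjacent⇒≢ : ∀ {u v} → adj G u v ≡ true → u ≢ v
  adjacent⇒≢ {u} a refl with () ← trans (sym a) (Graph.irrefl G u)

  first : ∀ {P u v k} → WalkIn G P u v k → P u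
  first (nil p)      = p
  first (cons p _ _) = p

  snoc : ∀ {P u v w k} → WalkIn G P u v k → adj G v w ≡ true → P w → WalkIn G P u w (suc k)
  snoc (nil p)      e pw = cons p e (nil pw)
  snoc (cons p a r) e pw = cons p a (snoc r e pw)

  reverse : ∀ {P u v k} → WalkIn G P u v k → WalkIn G P v u k
  reverse (nil p)              = nil p
  reverse {u = u} (cons p e r) = snoc (reverse r) (trans (Graph.sym G _ u) e) p

  walk-colour : ∀ {c} → Proper G c → ∀ {P u v k} → WalkIn G P u v k → c v ≡ flips k (c u)
  walk-colour proper (nil _) = refl
  walk-colour {c} proper {k = suc k} (cons {u} {w} _ e r) =
    trans (walk-colour proper r) (cong (flips k) (¬-not (proper u w e ∘ sym)))

  no-triangle : ∀ {c} → Proper G c → TriangleFree G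
  no-triangle {c} proper u v w uv vw uw =
    no-three-booleans (c u) (c v) (c w) (proper u v uv) (proper v w vw) (proper u w uw)

module Distance {n : ℕ} (G : Graph n) (d : Fin n → Fin n → ℕ) (isDist : IsDistance G d) where
  open Walks G

  shortest : ∀ u v → Walk G u v (d u v)
  shortest u v = proj₁ (isDist u v)

  minimal : ∀ {u v k} → Walk G u v k → d u v ≤ k
  minimal {u} {v} {k} w = proj₂ (isDist u v) k w

  d-refl : ∀ u → d u u ≡ 0
  d-refl u = n≤0⇒n≡0 (minimal (nil tt))

  d-sym : ∀ u v → d u v ≡ d v u
  d-sym u v = ≤-antisym (minimal (reverse (shortest v u))) (minimal (reverse (shortest u v)))

  d≡0⇒≡ : ∀ {u v} → d u v ≡ 0 → u ≡ v
  d≡0⇒≡ {u} {v} e = walk0 (subst (Walk G u v) e (shortest u v))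
    where
    walk0 : Walk G u v 0 → u ≡ v
    walk0 (nil _) = refl

  d≡1⇒adj : ∀ {u v} → d u v ≡ 1 → adj G u v ≡ true
  d≡1⇒adj {u} {v} e = walk1 (subst (Walk G u v) e (shortest u v))
    where
    walk1 : Walk G u v 1 → adj G u v ≡ true
    walk1 (cons _ a (nil _)) = a

  d-step : ∀ {u v} z → adj G u v ≡ true → d u z ≤ suc (d v z)
  d-step z a = minimal (cons tt a (shortest _ z))

  d-step-back : ∀ {u v} z → adj G u v ≡ true → d v z ≤ suc (d u z)
  d-step-back {u} {v} z a = d-step z (trans (Graph.sym G v u) a)

  d≥1 : ∀ {u v} → u ≢ v → 1 ≤ d u v
  d≥1 {u} {v} u≢v with d u v in e
  ... | zero  = ⊥-elim (u≢v (d≡0⇒≡ e))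
  ... | suc _ = s≤s z≤n

  d≥2 : ∀ {u v} → u ≢ v → adj G u v ≡ false → 2 ≤ d u v
  d≥2 {u} {v} u≢v na with d u v in e
  ... | zero        = ⊥-elim (u≢v (d≡0⇒≡ e))
  ... | suc zero    with () ← trans (sym na) (d≡1⇒adj e)
  ... | suc (suc _) = s≤s (s≤s z≤n)

  d-adjacent : ∀ {u v} → adj G u v ≡ true → d u v ≡ 1
  d-adjacent a = ≤-antisym (minimal (cons tt a (nil tt))) (d≥1 (adjacent⇒≢ a))

  d-common-neighbour : ∀ {u v w} → u ≢ v → adj G u v ≡ false →
    adj G u w ≡ true → adj G w v ≡ true → d u v ≡ 2
  d-common-neighbour u≢v na uw wv =
    ≤-antisym (minimal (cons tt uw (cons tt wv (nil tt)))) (d≥2 u≢v na)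

  d-edge-≢ : ∀ {c} → Proper G c → ∀ {u v} z → adj G u v ≡ true → d u z ≢ d v z
  d-edge-≢ {c} proper {u} {v} z a e = proper u v a (flips-injective (d v z) same-flips)
    where
    same-flips : flips (d v z) (c u) ≡ flips (d v z) (c v)
    same-flips = trans
      (sym (subst (λ k → c z ≡ flips k (c u)) e (walk-colour proper (shortest u z))))
      (walk-colour proper (shortest v z))

upper : ∀ {n} → (Fin n → Fin n → ℕ) → Fin n → Fin n → ℕ
upper F u v = if toℕ u <ᵇ toℕ v then F u v else 0

upper+lower : ∀ {n} (F : Fin n → Fin n → ℕ) → (∀ u v → F u v ≡ F v u) → (∀ u → F u u ≡ 0) →
  ∀ u v → F u v ≡ upper F u v + upper F v u
upper+lower F F-sym F-diag u v with toℕ u <ᵇ toℕ v in u<v | toℕ v <ᵇ toℕ u in v<u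
... | true  | true  = ⊥-elim (<-asym (<ᵇ-true⇒< {toℕ u} u<v) (<ᵇ-true⇒< {toℕ v} v<u))
... | true  | false = sym (+-identityʳ _)
... | false | true  = F-sym u v
... | false | false = trans (cong (F u) (sym u≡v)) (F-diag u)
  where
  u≡v : u ≡ v
  u≡v = toℕ-injective (≤-antisym (<ᵇ-false⇒≥ {toℕ v} v<u) (<ᵇ-false⇒≥ {toℕ u} u<v))

∑∑-symmetric : ∀ {n} (F : Fin n → Fin n → ℕ) → (∀ u v → F u v ≡ F v u) → (∀ u → F u u ≡ 0) →
  ∑ (λ u → ∑ (λ v → F u v)) ≡ 2 * ∑ (λ u → ∑ (λ v → upper F u v))
∑∑-symmetric F F-sym F-diag = begin
  ∑ (λ u → ∑ (λ v → F u v))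
    ≡⟨ ∑-cong (λ u → ∑-cong (upper+lower F F-sym F-diag u)) ⟩
  ∑ (λ u → ∑ (λ v → upper F u v + upper F v u))
    ≡⟨ ∑-cong (λ u → ∑-+ (upper F u) (λ v → upper F v u)) ⟩
  ∑ (λ u → ∑ (upper F u) + ∑ (λ v → upper F v u))
    ≡⟨ ∑-+ (λ u → ∑ (upper F u)) (λ u → ∑ (λ v → upper F v u)) ⟩
  S + ∑ (λ u → ∑ (λ v → upper F v u))
    ≡⟨ cong (S +_) (∑-swap (λ u v → upper F v u)) ⟩
  S + S
    ≡⟨ cong (S +_) (+-identityʳ S) ⟨
  2 * S ∎
  where
  open ≡-Reasoning
  S = ∑ (λ u → ∑ (λ v → upper F u v))

module SzegedCount {n : ℕ} (G : Graph n) (d : Fin n → Fin n → ℕ) where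

  separates : Fin n → Fin n → Fin n → Fin n → Bool
  separates u v x y = adj G u v ∧ (d u x <ᵇ d v x) ∧ (d v y <ᵇ d u y)

  separates-intro : ∀ {u v x y} → adj G u v ≡ true → d u x < d v x → d v y < d u y →
    separates u v x y ≡ true
  separates-intro a p q rewrite a | <⇒<ᵇ-true p | <⇒<ᵇ-true q = refl

  edge-term : Fin n → Fin n → ℕ
  edge-term u v = if adj G u v then nCloser d u v * nCloser d v u else 0

  Sz≡upper : Sz G d ≡ ∑ (λ u → ∑ (λ v → upper edge-term u v))
  Sz≡upper = ∑-cong λ u → ∑-cong λ v → by-order u v
    where
    by-order : ∀ u v → (if (toℕ u <ᵇ toℕ v) ∧ adj G u v then nCloser d u v * nCloser d v u else 0)
                       ≡ upper edge-term u v
    by-order u v with toℕ u <ᵇ toℕ v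
    ... | true  = refl
    ... | false = refl

  edge-term-sym : ∀ u v → edge-term u v ≡ edge-term v u
  edge-term-sym u v rewrite Graph.sym G u v with adj G v u
  ... | true  = *-comm (nCloser d u v) (nCloser d v u)
  ... | false = refl

  edge-term-diag : ∀ u → edge-term u u ≡ 0
  edge-term-diag u rewrite Graph.irrefl G u = refl

  edge-term≡separated : ∀ u v → edge-term u v ≡ ∑ (λ x → ∑ (λ y → ind (separates u v x y)))
  edge-term≡separated u v with adj G u v
  ... | true  = trans (∑-product (λ x → ind (d u x <ᵇ d v x)) (λ y → ind (d v y <ᵇ d u y)))
                      (∑-cong λ x → ∑-cong λ y → sym (ind-∧ (d u x <ᵇ d v x) (d v y <ᵇ d u y)))
  ... | false = sym (trans (∑-cong {n} {g = λ _ → 0} λ x → ∑-zero {n}) (∑-zero {n}))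

  2Sz≡separations : 2 * Sz G d ≡ ∑ (λ x → ∑ (λ y → ∑ (λ u → ∑ (λ v → ind (separates u v x y)))))
  2Sz≡separations = begin
    2 * Sz G d
      ≡⟨ cong (2 *_) Sz≡upper ⟩
    2 * ∑ (λ u → ∑ (λ v → upper edge-term u v))
      ≡⟨ ∑∑-symmetric edge-term edge-term-sym edge-term-diag ⟨
    ∑ (λ u → ∑ (λ v → edge-term u v))
      ≡⟨ ∑-cong (λ u → ∑-cong (edge-term≡separated u)) ⟩
    ∑ (λ u → ∑ (λ v → ∑ (λ x → ∑ (λ y → σ u v x y))))
      ≡⟨ ∑-cong (λ u → ∑-swap (λ v x → ∑ (σ u v x))) ⟩
    ∑ (λ u → ∑ (λ x → ∑ (λ v → ∑ (λ y → σ u v x y))))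
      ≡⟨ ∑-swap (λ u x → ∑ (λ v → ∑ (σ u v x))) ⟩
    ∑ (λ x → ∑ (λ u → ∑ (λ v → ∑ (λ y → σ u v x y))))
      ≡⟨ ∑-cong (λ x → ∑-cong (λ u → ∑-swap (λ v y → σ u v x y))) ⟩
    ∑ (λ x → ∑ (λ u → ∑ (λ y → ∑ (λ v → σ u v x y))))
      ≡⟨ ∑-cong (λ x → ∑-swap (λ u y → ∑ (λ v → σ u v x y))) ⟩
    ∑ (λ x → ∑ (λ y → ∑ (λ u → ∑ (λ v → σ u v x y)))) ∎
    where
    open ≡-Reasoning
    σ : Fin n → Fin n → Fin n → Fin n → ℕ
    σ u v x y = ind (separates u v x y)

third : ∀ {n} → 3 ≤ n → (a b : Fin n) → ∃ λ z → z ≢ a × z ≢ b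
third {suc (suc zero)} (s≤s (s≤s ())) _ _
third {suc (suc (suc _))} _ zero          zero          = suc zero , (λ ()) , (λ ())
third {suc (suc (suc _))} _ zero          (suc zero)    = suc (suc zero) , (λ ()) , (λ ())
third {suc (suc (suc _))} _ zero          (suc (suc _)) = suc zero , (λ ()) , (λ ())
third {suc (suc (suc _))} _ (suc zero)    zero          = suc (suc zero) , (λ ()) , (λ ())
third {suc (suc (suc _))} _ (suc zero)    (suc _)       = zero , (λ ()) , (λ ())
third {suc (suc (suc _))} _ (suc (suc _)) zero          = suc zero , (λ ()) , (λ ())
third {suc (suc (suc _))} _ (suc (suc _)) (suc _)       = zero , (λ ()) , (λ ())

MinDegreeTwo : ∀ {n} → Graph n → Set
MinDegreeTwo G = ∀ v w → v ≢ w → ∃ λ u → u ≢ w × adj G v u ≡ true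

module Cuts {n : ℕ} (G : Graph n) (twoConn : TwoConnected G) where
  open Walks G

  avoiding : ∀ w u v → u ≢ w → v ≢ w → ∃ λ k → WalkIn G (λ z → z ≢ w) u v k
  avoiding = proj₂ (proj₂ twoConn)

  -- Every vertex v has a neighbour other than any prescribed w ≢ v: follow a walk in
  -- G - w from v to a third vertex.
  other-neighbour : MinDegreeTwo G
  other-neighbour v w v≢w with third (proj₁ twoConn) v w
  ... | z , z≢v , z≢w = first-step (proj₂ (avoiding w v z v≢w z≢w)) z≢v
    where
    first-step : ∀ {a k} → WalkIn G (λ x → x ≢ w) a z k → z ≢ a → ∃ λ u → u ≢ w × adj G a u ≡ true
    first-step (nil _)      z≢a = ⊥-elim (z≢a refl)
    first-step (cons _ e r) _   = _ , first r , e

  record Crossing (S : Fin n → Bool) : Set where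
    constructor crossing
    field
      from to : Fin n
      edge    : adj G from to ≡ true
      inside  : S from ≡ true
      outside : S to ≡ false
  open Crossing

  leaving : (Fin n → Bool) → Fin n → Fin n → Bool
  leaving S u v = adj G u v ∧ S u ∧ not (S v)

  crossing-leaving : ∀ {S} (c : Crossing S) → leaving S (from c) (to c) ≡ true
  crossing-leaving (crossing _ _ e i o) rewrite e | i | o = refl

  leaving-parts : ∀ S {u v} → leaving S u v ≡ true → adj G u v ≡ true × S u ≡ true × S v ≡ false
  leaving-parts S {u} {v} e with adj G u v | S u | S v
  ... | true  | true  | false = refl , refl , refl
  ... | true  | true  | true  with () ← e
  ... | true  | false | _     with () ← e
  ... | false | _     | _     with () ← e

  crossing-on-walk : ∀ S {P a b k} → WalkIn G P a b k → S a ≡ true → S b ≡ false →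
    Σ (Crossing S) λ c → P (from c) × P (to c)
  crossing-on-walk S (nil _)              sa sb with () ← trans (sym sa) sb
  crossing-on-walk S (cons {w = w} p e r) sa sb with S w in sw
  ... | true  = crossing-on-walk S r sw sb
  ... | false = crossing _ _ e sa sw , p , first r

  crossing-avoiding : ∀ S w {a b} → a ≢ w → b ≢ w → S a ≡ true → S b ≡ false →
    Σ (Crossing S) λ c → from c ≢ w × to c ≢ w
  crossing-avoiding S w a≢w b≢w = crossing-on-walk S (proj₂ (avoiding w _ _ a≢w b≢w))

  -- Every crossing uv of S has a companion: a third vertex z lies inside S (cross from z
  -- to v in G - u) or outside S (cross from u to z in G - v).
  another-crossing : ∀ {S} (c : Crossing S) →
    Σ (Crossing S) λ c' → from c ≢ from c' ⊎ to c ≢ to c'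
  another-crossing {S} (crossing u v e su sv) with third (proj₁ twoConn) u v
  ... | z , z≢u , z≢v with S z in sz
  ... | true  = let c' , u'≢u , _ = crossing-avoiding S u z≢u (adjacent⇒≢ e ∘ sym) sz sv
                in c' , inj₁ (u'≢u ∘ sym)
  ... | false = let c' , _ , v'≢v = crossing-avoiding S v (adjacent⇒≢ e) z≢v su sz
                in c' , inj₂ (v'≢v ∘ sym)

  cut-size : ∀ S {x y} → S x ≡ true → S y ≡ false → 2 ≤ ∑ (λ u → ∑ (λ v → ind (leaving S u v)))
  cut-size S {x} {y} sx sy =
    subst (_≤ ∑ (λ u → ∑ (λ v → ind (leaving S u v))))
          (cong₂ _+_ (cong ind (crossing-leaving c)) (cong ind (crossing-leaving c')))
          (∑∑-two-terms (λ u v → ind (leaving S u v)) differ)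
    where
    c = proj₁ (crossing-on-walk S (proj₂ (proj₁ (proj₂ twoConn) x y)) sx sy)
    c' = proj₁ (another-crossing c)
    differ = proj₂ (another-crossing c)

-- Write a, b (resp. a', b') for the
-- distances from u (resp. v) to x and y, and D for d(x,y); u lies in the level set
-- (a + D ≤ T + b) while v does not (T + b' < a' + D).

level-exit-x : ∀ {a a' b b' D T} → b ≤ suc b' → a + D ≤ T + b → T + b' < a' + D → a ≤ a'
level-exit-x {a} {a'} {b} {b'} {D} {T} b≤1+b' inside outside = +-cancelʳ-≤ D a a' (begin
  a + D        ≤⟨ inside ⟩
  T + b        ≤⟨ +-monoʳ-≤ T b≤1+b' ⟩
  T + suc b'   ≡⟨ +-suc T b' ⟩
  suc (T + b') ≤⟨ outside ⟩
  a' + D       ∎)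
  where open ≤-Reasoning

level-exit-y : ∀ {a a' b b' D T} → a' ≤ suc a → a + D ≤ T + b → T + b' < a' + D → b' ≤ b
level-exit-y {a} {a'} {b} {b'} {D} {T} a'≤1+a inside outside =
  +-cancelˡ-≤ T b' b (m<1+n⇒m≤n (begin-strict
    T + b'       <⟨ outside ⟩
    a' + D       ≤⟨ +-monoˡ-≤ D a'≤1+a ⟩
    suc (a + D)  ≤⟨ s≤s inside ⟩
    suc (T + b)  ∎))
  where open ≤-Reasoning

-- If uv leaves the level set of t' and u lies in that of t, then t' ≤ t.
level-exit-order : ∀ {a a' b b' D t t'} → a' ≤ suc a → b ≤ suc b' →
  a + D ≤ 2 * t + b → 2 * t' + b' < a' + D → t' ≤ t
level-exit-order {a} {a'} {b} {b'} {D} {t} {t'} a'≤1+a b≤1+b' inside outside =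
  m<1+n⇒m≤n (*-cancelˡ-< 2 t' (suc t) (+-cancelʳ-< b' (2 * t') (2 * suc t) (begin-strict
    2 * t' + b'           <⟨ outside ⟩
    a' + D                ≤⟨ +-monoˡ-≤ D a'≤1+a ⟩
    suc (a + D)           ≤⟨ s≤s inside ⟩
    suc (2 * t + b)       ≤⟨ s≤s (+-monoʳ-≤ (2 * t) b≤1+b') ⟩
    suc (2 * t + suc b')  ≡⟨ cong suc (+-suc (2 * t) b') ⟩
    2 + 2 * t + b'        ≡⟨ cong (_+ b') (*-distribˡ-+ 2 1 t) ⟨
    2 * suc t + b'        ∎)))
  where open ≤-Reasoning

module Separation {n : ℕ} (G : Graph n) (d : Fin n → Fin n → ℕ) (isDist : IsDistance G d)
                  (twoConn : TwoConnected G) {c : Fin n → Bool} (proper : Proper G c)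
                  (x y : Fin n) where
  open Distance G d isDist
  open Cuts G twoConn
  open SzegedCount G d

  D : ℕ
  D = d x y

  level : ℕ → Fin n → Bool
  level t w = d w x + D ≤ᵇ 2 * t + d w y

  x∈level : ∀ t → level t x ≡ true
  x∈level t rewrite d-refl x = ≤⇒≤ᵇ-true (m≤n+m D (2 * t))

  y∉level : ∀ t → t < D → level t y ≡ false
  y∉level t t<D rewrite d-refl y | d-sym y x =
    >⇒≤ᵇ-false (subst (_< D + D) (sym (+-identityʳ (2 * t)))
                      (+-mono-< t<D (subst (_< D) (sym (+-identityʳ t)) t<D)))

  leaving⇒separates : ∀ t u v → leaving (level t) u v ≡ true → separates u v x y ≡ true
  leaving⇒separates t u v e with leaving-parts (level t) e
  ... | uv , u-in , v-out = separates-intro uv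
    (≤∧≢⇒< (level-exit-x (d-step y uv) inside outside) (d-edge-≢ proper x uv))
    (≤∧≢⇒< (level-exit-y (d-step-back x uv) inside outside) (d-edge-≢ proper y uv ∘ sym))
    where
    inside = ≤ᵇ-true⇒≤ u-in
    outside = ≤ᵇ-false⇒> v-out

  leaving-unique : ∀ t t' u v →
    leaving (level t) u v ≡ true → leaving (level t') u v ≡ true → t ≡ t'
  leaving-unique t t' u v e e' with leaving-parts (level t) e | leaving-parts (level t') e'
  ... | uv , u-in , v-out | _ , u-in' , v-out' = ≤-antisym
    (level-exit-order (d-step-back x uv) (d-step y uv) (≤ᵇ-true⇒≤ u-in') (≤ᵇ-false⇒> v-out))
    (level-exit-order (d-step-back x uv) (d-step y uv) (≤ᵇ-true⇒≤ u-in) (≤ᵇ-false⇒> v-out'))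

  levels-left : ∀ u v → ∑ {D} (λ t → ind (leaving (level (toℕ t)) u v)) ≤ ind (separates u v x y)
  levels-left u v with separates u v x y in sep
  ... | true  = ∑-ind≤1 {D} (λ t → leaving (level (toℕ t)) u v)
                        (λ i j p q → toℕ-injective (leaving-unique (toℕ i) (toℕ j) u v p q))
  ... | false = ≤-reflexive (trans (∑-cong {D} none) (∑-zero {D}))
    where
    none : ∀ t → ind (leaving (level (toℕ t)) u v) ≡ 0
    none t with leaving (level (toℕ t)) u v in e
    ... | false = refl
    ... | true  with () ← trans (sym sep) (leaving⇒separates (toℕ t) u v e)

  -- Each of the d(x,y) level sets is left by at least two edges, and no edge is counted
  -- twice: x and y are separated by at least 2 d(x,y) oriented edges.
  separation-bound : 2 * D ≤ ∑ (λ u → ∑ (λ v → ind (separates u v x y)))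
  separation-bound = begin
    2 * D                                        ≡⟨ *-comm 2 D ⟩
    D * 2                                        ≡⟨ ∑-const {D} 2 ⟨
    ∑ {D} (λ _ → 2)                              ≤⟨ ∑-mono {D} two-leave ⟩
    ∑ (λ t → ∑ (λ u → ∑ (λ v → L t u v)))        ≡⟨ ∑-swap (λ t u → ∑ (L t u)) ⟩
    ∑ (λ u → ∑ (λ t → ∑ (λ v → L t u v)))        ≡⟨ ∑-cong (λ u → ∑-swap (λ t v → L t u v)) ⟩
    ∑ (λ u → ∑ (λ v → ∑ (λ t → L t u v)))        ≤⟨ ∑-mono (λ u → ∑-mono (levels-left u)) ⟩
    ∑ (λ u → ∑ (λ v → ind (separates u v x y)))  ∎
    where
    open ≤-Reasoning
    two-leave : ∀ (t : Fin D) → 2 ≤ ∑ (λ u → ∑ (λ v → ind (leaving (level (toℕ t)) u v)))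
    two-leave t = cut-size (level (toℕ t)) (x∈level (toℕ t)) (y∉level (toℕ t) (toℕ<n t))
    L : Fin D → Fin n → Fin n → ℕ
    L t u v = ind (leaving (level (toℕ t)) u v)

module Transmission {n : ℕ} (G : Graph n) (d : Fin n → Fin n → ℕ) (isDist : IsDistance G d)
                    (twoConn : TwoConnected G) {c : Fin n → Bool} (proper : Proper G c) where
  open Walks G
  open Distance G d isDist
  open Cuts G twoConn

  -- No vertex x is adjacent to all others: pick a ≠ x and a neighbour w ≠ x of a;
  -- if x were adjacent to both, x, a, w would form a triangle.
  non-neighbour : ∀ x → ∃ λ z → z ≢ x × adj G x z ≡ false
  non-neighbour x with third (proj₁ twoConn) x x
  ... | a , a≢x , _ with other-neighbour a x a≢x
  ... | w , w≢x , aw with adj G x a in xa | adj G x w in xw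
  ... | false | _     = a , a≢x , xa
  ... | true  | false = w , w≢x , xw
  ... | true  | true  = ⊥-elim (no-triangle proper x a w xa aw xw)

  -- The transmission of every vertex is at least n: all other vertices are at distance
  -- at least 1, and a non-neighbour z at distance at least 2.
  transmission : ∀ x → n ≤ ∑ (λ y → d x y)
  transmission x with non-neighbour x
  ... | z , z≢x , xz = +-cancelˡ-≤ 1 n (∑ (d x)) (begin
    1 + n                             ≡⟨ +-comm 1 n ⟩
    n + 1                             ≡⟨ cong₂ _+_ (trans (sym (*-identityʳ n)) (sym (∑-const {n} 1)))
                                                   (sym (∑-point z)) ⟩
    ∑ {n} (λ _ → 1) + ∑ (λ y → δ y z) ≡⟨ ∑-+ (λ _ → 1) (λ y → δ y z) ⟨
    ∑ (λ y → 1 + δ y z)               ≤⟨ ∑-mono pointwise ⟩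
    ∑ (λ y → δ y x + d x y)           ≡⟨ ∑-+ (λ y → δ y x) (d x) ⟩
    ∑ (λ y → δ y x) + ∑ (d x)         ≡⟨ cong (_+ ∑ (d x)) (∑-point x) ⟩
    1 + ∑ (d x)                       ∎)
    where
    open ≤-Reasoning
    pointwise : ∀ y → 1 + δ y z ≤ δ y x + d x y
    pointwise y with y ≟ x | y ≟ z
    ... | yes refl | yes refl = ⊥-elim (z≢x refl)
    ... | yes refl | no _     = s≤s z≤n
    ... | no y≢x   | yes refl = d≥2 (y≢x ∘ sym) xz
    ... | no y≢x   | no _     = d≥1 (y≢x ∘ sym)

module IndexBounds {n : ℕ} (G : Graph n) (d : Fin n → Fin n → ℕ) (isDist : IsDistance G d)
                   (twoConn : TwoConnected G) (bipartite : Bipartite G) where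
  open Distance G d isDist
  open SzegedCount G d
  open Transmission G d isDist twoConn (proj₂ bipartite)

  2W≡∑∑d : 2 * W G d ≡ ∑ (λ x → ∑ (λ y → d x y))
  2W≡∑∑d = sym (∑∑-symmetric d d-sym d-refl)

  -- Summing the separation bound over all pairs: Sz(G) ≥ 2 W(G).
  Sz≥2W : 2 * W G d ≤ Sz G d
  Sz≥2W = *-cancelˡ-≤ 2 (begin
    2 * (2 * W G d)                                  ≡⟨ cong (2 *_) 2W≡∑∑d ⟩
    2 * ∑ (λ x → ∑ (λ y → d x y))                    ≡⟨ ∑-*ˡ 2 (λ x → ∑ (d x)) ⟩
    ∑ (λ x → 2 * ∑ (λ y → d x y))                    ≡⟨ ∑-cong (λ x → ∑-*ˡ 2 (d x)) ⟩
    ∑ (λ x → ∑ (λ y → 2 * d x y))                    ≤⟨ ∑-mono (λ x → ∑-mono (separation x)) ⟩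
    ∑ (λ x → ∑ (λ y → ∑ (λ u → ∑ (λ v → ind (separates u v x y))))) ≡⟨ 2Sz≡separations ⟨
    2 * Sz G d                                       ∎)
    where
    open ≤-Reasoning
    separation : ∀ x y → 2 * d x y ≤ ∑ (λ u → ∑ (λ v → ind (separates u v x y)))
    separation = Separation.separation-bound G d isDist twoConn (proj₂ bipartite)

  -- Summing the transmission bound over all vertices: 2 W(G) ≥ n².
  2W≥n² : n * n ≤ 2 * W G d
  2W≥n² = begin
    n * n                          ≡⟨ ∑-const {n} n ⟨
    ∑ {n} (λ _ → n)                ≤⟨ ∑-mono transmission ⟩
    ∑ (λ x → ∑ (λ y → d x y))      ≡⟨ 2W≡∑∑d ⟨
    2 * W G d                      ∎
    where open ≤-Reasoning

-- 8n ≤ n² + 16 for n = 4 + k, with the defect k² = (n - 4)² made explicit.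
square-excess : ∀ k → (4 + k) * (4 + k) + 16 ≡ 8 * (4 + k) + k * k
square-excess = solve-∀

doubled-bound : ∀ {w s n} → 2 * w ≤ s → n * n ≤ 2 * w → 2 * w + (n * n + 16) ≤ 2 * (s + 8)
doubled-bound {w} {s} {n} 2w≤s n²≤2w = begin
  2 * w + (n * n + 16)   ≤⟨ +-monoʳ-≤ (2 * w) (+-monoˡ-≤ 16 n²≤2w) ⟩
  2 * w + (2 * w + 16)   ≤⟨ +-mono-≤ 2w≤s (+-monoˡ-≤ 16 2w≤s) ⟩
  s + (s + 16)           ≡⟨ regroup s ⟩
  2 * (s + 8)            ∎
  where
  open ≤-Reasoning
  regroup : ∀ s → s + (s + 16) ≡ 2 * (s + 8)
  regroup = solve-∀

double-+ : ∀ w n → 2 * (w + 4 * n) ≡ 2 * w + 8 * n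
double-+ = solve-∀

-- With s = Sz, w = W: from Sz ≥ 2W ≥ n² and n ≥ 4, W + 4n ≤ Sz + 8 ...
index-inequality : ∀ {w s n} → 2 * w ≤ s → n * n ≤ 2 * w → 4 ≤ n → w + 4 * n ≤ s + 8
index-inequality {w} {s} {n@(suc (suc (suc (suc k))))} 2w≤s n²≤2w (s≤s (s≤s (s≤s (s≤s _)))) =
  *-cancelˡ-≤ 2 (begin
    2 * (w + 4 * n)        ≡⟨ double-+ w n ⟩
    2 * w + 8 * n          ≤⟨ +-monoʳ-≤ (2 * w) (m≤m+n (8 * n) (k * k)) ⟩
    2 * w + (8 * n + k * k) ≡⟨ cong (2 * w +_) (square-excess k) ⟨
    2 * w + (n * n + 16)   ≤⟨ doubled-bound {w} {s} {n} 2w≤s n²≤2w ⟩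
    2 * (s + 8)            ∎)
  where open ≤-Reasoning

-- ... and equality forces (n - 4)² = 0, i.e. n = 4.
index-equality : ∀ {w s n} → 2 * w ≤ s → n * n ≤ 2 * w → 4 ≤ n → s + 8 ≡ w + 4 * n → n ≡ 4
index-equality {w} {s} {n@(suc (suc (suc (suc k))))} 2w≤s n²≤2w (s≤s (s≤s (s≤s (s≤s _)))) eq =
  cong (4 +_) (square-zero k (+-cancelˡ-≤ (2 * w + 8 * n) (k * k) 0 (begin
    2 * w + 8 * n + k * k   ≡⟨ +-assoc (2 * w) (8 * n) (k * k) ⟩
    2 * w + (8 * n + k * k) ≡⟨ cong (2 * w +_) (square-excess k) ⟨
    2 * w + (n * n + 16)   ≤⟨ doubled-bound {w} {s} {n} 2w≤s n²≤2w ⟩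
    2 * (s + 8)            ≡⟨ cong (2 *_) eq ⟩
    2 * (w + 4 * n)        ≡⟨ double-+ w n ⟩
    2 * w + 8 * n          ≡⟨ +-identityʳ _ ⟨
    2 * w + 8 * n + 0      ∎)))
  where
  open ≤-Reasoning
  square-zero : ∀ k → k * k ≤ 0 → k ≡ 0
  square-zero zero    _  = refl
  square-zero (suc k) ()

C4 : Graph 4
C4 = record
  { adj    = c4adj
  ; sym    = toWitness {a? = all? λ u → all? λ v → c4adj u v ≟ᵇ c4adj v u} _
  ; irrefl = λ { 0F → refl ; 1F → refl ; 2F → refl ; 3F → refl }
  }

four-cycle-shape : (G : Graph 4) → TriangleFree G → MinDegreeTwo G → adj G 0F 2F ≡ false →
  ∀ u v → adj G u v ≡ c4adj u v
four-cycle-shape G triangle-free min-degree e02 = shape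
  where
  forced : ∀ {v w x} → v ≢ w → (∀ u → u ≢ w → u ≢ x → adj G v u ≡ false) → adj G v x ≡ true
  forced {v} {w} {x} v≢w excluded with min-degree v w v≢w
  ... | u , u≢w , vu with u ≟ x
  ...   | yes refl = vu
  ...   | no  u≢x  with () ← trans (sym (excluded u u≢w u≢x)) vu

  sym-adj : ∀ {u v b} → adj G u v ≡ b → adj G v u ≡ b
  sym-adj {u} {v} e = trans (Graph.sym G v u) e

  -- 0 has a neighbour besides 3 and one besides 1, and 2 is not one: so 0 ~ 1 and 0 ~ 3.
  -- Then 1 ≁ 3 (no triangle), and 1 and 3 have neighbours besides 0, necessarily 2.
  e01 : adj G 0F 1F ≡ true
  e01 = forced {w = 3F} (λ ()) λ { 0F _ _ → Graph.irrefl G 0F ; 1F _ ≢1 → ⊥-elim (≢1 refl)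
                                ; 2F _ _ → e02 ; 3F ≢3 _ → ⊥-elim (≢3 refl) }

  e03 : adj G 0F 3F ≡ true
  e03 = forced {w = 1F} (λ ()) λ { 0F _ _ → Graph.irrefl G 0F ; 1F ≢1 _ → ⊥-elim (≢1 refl)
                                ; 2F _ _ → e02 ; 3F _ ≢3 → ⊥-elim (≢3 refl) }

  e13 : adj G 1F 3F ≡ false
  e13 = ¬-not (triangle-free 1F 0F 3F (sym-adj e01) e03)

  e12 : adj G 1F 2F ≡ true
  e12 = forced {w = 0F} (λ ()) λ { 0F ≢0 _ → ⊥-elim (≢0 refl) ; 1F _ _ → Graph.irrefl G 1F
                                ; 2F _ ≢2 → ⊥-elim (≢2 refl) ; 3F _ _ → e13 }

  e32 : adj G 3F 2F ≡ true
  e32 = forced {w = 0F} (λ ()) λ { 0F ≢0 _ → ⊥-elim (≢0 refl) ; 1F _ _ → sym-adj e13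
                                ; 2F _ ≢2 → ⊥-elim (≢2 refl) ; 3F _ _ → Graph.irrefl G 3F }

  shape : ∀ u v → adj G u v ≡ c4adj u v
  shape 0F 0F = Graph.irrefl G 0F
  shape 0F 1F = e01
  shape 0F 2F = e02
  shape 0F 3F = e03
  shape 1F 0F = sym-adj e01
  shape 1F 1F = Graph.irrefl G 1F
  shape 1F 2F = e12
  shape 1F 3F = e13
  shape 2F 0F = sym-adj e02
  shape 2F 1F = sym-adj e12
  shape 2F 2F = Graph.irrefl G 2F
  shape 2F 3F = sym-adj e32
  shape 3F 0F = sym-adj e03
  shape 3F 1F = sym-adj e13
  shape 3F 2F = e32
  shape 3F 3F = Graph.irrefl G 3F

pullback : ∀ {m n} → (Fin m → Fin n) → Graph n → Graph m
pullback f G = record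
  { adj    = λ u v → adj G (f u) (f v)
  ; sym    = λ u v → Graph.sym G (f u) (f v)
  ; irrefl = λ u → Graph.irrefl G (f u)
  }

module Relabelling {m n : ℕ} (σ : Fin n ↔ Fin m) (G : Graph n) where
  open Inverse σ

  H : Graph m
  H = pullback from G

  from-injective : ∀ {v w} → from v ≡ from w → v ≡ w
  from-injective {v} {w} e =
    trans (sym (strictlyInverseˡ v)) (trans (cong to e) (strictlyInverseˡ w))

  adj-relabelled : ∀ u v → adj G u v ≡ adj H (to u) (to v)
  adj-relabelled u v = sym (cong₂ (adj G) (strictlyInverseʳ u) (strictlyInverseʳ v))

  triangle-free : TriangleFree G → TriangleFree H
  triangle-free no-triangle u v w = no-triangle (from u) (from v) (from w)

  min-degree : MinDegreeTwo G → MinDegreeTwo H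
  min-degree deg v w v≢w with deg (from v) (from w) (v≢w ∘ from-injective)
  ... | u , u≢w , vu =
    to u , (λ e → u≢w (trans (sym (strictlyInverseʳ u)) (cong from e))) ,
    subst (λ z → adj G (from v) z ≡ true) (sym (strictlyInverseʳ u)) vu

-- The distance function of a graph of diameter at most two.
dist₂ : ∀ {n} → (Fin n → Fin n → Bool) → Fin n → Fin n → ℕ
dist₂ A u v = if does (u ≟ v) then 0 else if A u v then 1 else 2

dist₂-cong : ∀ {n} {A B : Fin n → Fin n → Bool} → (∀ u v → A u v ≡ B u v) →
  ∀ u v → dist₂ A u v ≡ dist₂ B u v
dist₂-cong A≡B u v = cong (λ b → if does (u ≟ v) then 0 else if b then 1 else 2) (A≡B u v)

DiameterTwo : ∀ {n} → Graph n → Set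
DiameterTwo G = ∀ u v → u ≢ v → adj G u v ≡ false → ∃ λ w → adj G u w ≡ true × adj G w v ≡ true

module _ {n : ℕ} (G : Graph n) (d : Fin n → Fin n → ℕ) (isDist : IsDistance G d) where
  open Distance G d isDist

  diameter-two-distance : DiameterTwo G → ∀ u v → d u v ≡ dist₂ (adj G) u v
  diameter-two-distance common u v with u ≟ v
  ... | yes refl = d-refl u
  ... | no u≢v with adj G u v in uv
  ...   | true  = d-adjacent uv
  ...   | false = let w , uw , wv = common u v u≢v uv in d-common-neighbour u≢v uv uw wv

C4-diameter-two : DiameterTwo C4
C4-diameter-two 0F 0F ≢ _ = ⊥-elim (≢ refl)
C4-diameter-two 0F 1F _ ()
C4-diameter-two 0F 2F _ _ = 1F , refl , refl
C4-diameter-two 0F 3F _ ()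
C4-diameter-two 1F 0F _ ()
C4-diameter-two 1F 1F ≢ _ = ⊥-elim (≢ refl)
C4-diameter-two 1F 2F _ ()
C4-diameter-two 1F 3F _ _ = 0F , refl , refl
C4-diameter-two 2F 0F _ _ = 1F , refl , refl
C4-diameter-two 2F 1F _ ()
C4-diameter-two 2F 2F ≢ _ = ⊥-elim (≢ refl)
C4-diameter-two 2F 3F _ ()
C4-diameter-two 3F 0F _ ()
C4-diameter-two 3F 1F _ _ = 0F , refl , refl
C4-diameter-two 3F 2F _ ()
C4-diameter-two 3F 3F ≢ _ = ⊥-elim (≢ refl)

iso-diameter-two : ∀ {n} {G : Graph n} → IsoC4 G → DiameterTwo G
iso-diameter-two {G = G} (σ , adj≡) u v u≢v uv
  with C4-diameter-two (Inverse.to σ u) (Inverse.to σ v)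
         (u≢v ∘ Injection.injective (↔⇒↣ σ)) (trans (sym (adj≡ u v)) uv)
... | w , pw , wq =
  from w ,
  trans (adj≡ u (from w)) (subst (λ z → c4adj (to u) z ≡ true) (sym (strictlyInverseˡ w)) pw) ,
  trans (adj≡ (from w) v) (subst (λ z → c4adj z (to v) ≡ true) (sym (strictlyInverseˡ w)) wq)
  where open Inverse σ

nCloser-cong : ∀ {n} {d d' : Fin n → Fin n → ℕ} → (∀ u v → d u v ≡ d' u v) →
  ∀ u v → nCloser d u v ≡ nCloser d' u v
nCloser-cong d≡d' u v =
  ∑-cong λ w → cong₂ (λ a b → if a <ᵇ b then 1 else 0) (d≡d' u w) (d≡d' v w)

Sz-cong : ∀ {n} {G H : Graph n} {d d' : Fin n → Fin n → ℕ} →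
  (∀ u v → adj G u v ≡ adj H u v) → (∀ u v → d u v ≡ d' u v) → Sz G d ≡ Sz H d'
Sz-cong adj≡ d≡d' = ∑-cong λ u → ∑-cong λ v →
  cong₂ (λ b m → if (toℕ u <ᵇ toℕ v) ∧ b then m else 0) (adj≡ u v)
        (cong₂ _*_ (nCloser-cong d≡d' u v) (nCloser-cong d≡d' v u))

W-cong : ∀ {n} {G H : Graph n} {d d' : Fin n → Fin n → ℕ} →
  (∀ u v → d u v ≡ d' u v) → W G d ≡ W H d'
W-cong d≡d' =
  ∑-cong λ u → ∑-cong λ v → cong (λ a → if toℕ u <ᵇ toℕ v then a else 0) (d≡d' u v)

-- The relabelling of {0,1,2,3} swapping a and 2; it makes a opposite to 0 in the 4-cycle.
swap-to-2 : Fin 4 → Fin 4 ↔ Fin 4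
swap-to-2 a = transpose a 2F

C4-at : Fin 4 → Graph 4
C4-at a = pullback (Inverse.to (swap-to-2 a)) C4

-- The indices of these labelled 4-cycles, by evaluation: Sz = 16, W = 8.
C4-indices : ∀ a → let H = C4-at a in Sz H (dist₂ (adj H)) + 8 ≡ W H (dist₂ (adj H)) + 4 * 4
C4-indices 0F = refl
C4-indices 1F = refl
C4-indices 2F = refl
C4-indices 3F = refl

opposite-of-0 : ∀ (G : Graph 4) a → a ≢ 0F → adj G 0F a ≡ false →
  adj G (Inverse.from (swap-to-2 a) 0F) (Inverse.from (swap-to-2 a) 2F) ≡ false
opposite-of-0 G 0F a≢0 _  = ⊥-elim (a≢0 refl)
opposite-of-0 G 1F _   0a = 0a
opposite-of-0 G 2F _   0a = 0a
opposite-of-0 G 3F _   0a = 0a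

-- The case n = 4: a 2-connected bipartite graph on four vertices is a 4-cycle (relabel a
-- non-neighbour of 0 as 2 and apply four-cycle-shape), and it attains equality.
order-four : ∀ {n} → n ≡ 4 → (G : Graph n) (d : Fin n → Fin n → ℕ) → IsDistance G d →
  TwoConnected G → Bipartite G → IsoC4 G × (Sz G d + 8 ≡ W G d + 4 * n)
order-four refl G d isDist twoConn (c , proper)
  with Transmission.non-neighbour G d isDist twoConn proper 0F
... | a , a≢0 , 0a = iso , indices
  where
  σ = swap-to-2 a
  open Inverse σ
  open Relabelling σ G

  shape : ∀ u v → adj G u v ≡ c4adj (to u) (to v)
  shape u v = trans (adj-relabelled u v)
    (four-cycle-shape H (triangle-free (Walks.no-triangle G proper))
                        (min-degree (Cuts.other-neighbour G twoConn))
                        (opposite-of-0 G a a≢0 0a) (to u) (to v))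

  iso : IsoC4 G
  iso = σ , shape

  distances : ∀ u v → d u v ≡ dist₂ (adj (C4-at a)) u v
  distances u v = trans (diameter-two-distance G d isDist (iso-diameter-two {G = G} iso) u v)
                        (dist₂-cong {B = adj (C4-at a)} shape u v)

  indices : Sz G d + 8 ≡ W G d + 4 * 4
  indices = begin
    Sz G d + 8                       ≡⟨ cong (_+ 8) (Sz-cong {G = G} {H = C} shape distances) ⟩
    Sz C (dist₂ (adj C)) + 8         ≡⟨ C4-indices a ⟩
    W C (dist₂ (adj C)) + 4 * 4      ≡⟨ cong (_+ 4 * 4) (W-cong {G = G} {H = C} distances) ⟨
    W G d + 4 * 4                    ∎
    where
    open ≡-Reasoning
    C = C4-at a

lemma2p1 : ∀ {n : ℕ} (G : Graph n) (d : Fin n → Fin n → ℕ) →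
    IsDistance G d → TwoConnected G → Bipartite G → 4 ≤ n →
    (W G d + 4 * n ≤ Sz G d + 8) × ((Sz G d + 8 ≡ W G d + 4 * n) ⇔ IsoC4 G)
lemma2p1 {n} G d isDist twoConn bipartite 4≤n = inequality , mk⇔ equality⇒C4 C4⇒equality
  where
  open IndexBounds G d isDist twoConn bipartite

  inequality : W G d + 4 * n ≤ Sz G d + 8
  inequality = index-inequality {W G d} {Sz G d} Sz≥2W 2W≥n² 4≤n

  equality⇒C4 : Sz G d + 8 ≡ W G d + 4 * n → IsoC4 G
  equality⇒C4 equal = proj₁ (order-four n≡4 G d isDist twoConn bipartite)
    where n≡4 = index-equality {W G d} {Sz G d} Sz≥2W 2W≥n² 4≤n equal

  C4⇒equality : IsoC4 G → Sz G d + 8 ≡ W G d + 4 * n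
  C4⇒equality (σ , _) = proj₂ (order-four (↔⇒≡ σ) G d isDist twoConn bipartite)
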